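{- For each integer $n \geq 0$, let $\pi_n$ be a uniformly random permutation in $S_n$ (with $S_0$ consisting of the empty permutation, whose order is $1$), and let $\mathrm{ord}(\pi_n)$ be its order. Then for any $m, n \in \mathbb{N}$, \[\mathbb{P}(\mathrm{ord}(\pi_n) = m) = \frac{1}{n}\sum_{\substack{0 \leq n' < n\\ n-n' \mid m}} \mathbb{P}\bigl(\mathrm{lcm}(\mathrm{ord}(\pi_{n'}), n-n') = m\bigr).\] In particular, for any $m, n \in \mathbb{N}$, \[\mathbb{P}(\mathrm{ord}(\pi_n) \mid m) \leq \frac{\tau(m)}{n},\] where $\tau(m)$ denotes the number of positive divisors of $m$. -}

module Defs where

open import Data.Bool.Base using (Bool; true; false; _∧_; if_then_else_)
open import Data.Nat.Base using (ℕ; zero; suc; _!; NonZero)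
open import Data.Nat.Properties using (_!≢0)
open import Data.Nat.Divisibility using (_∣?_)
open import Data.Fin.Base using (Fin)
open import Data.Fin.Properties using () renaming (_≟_ to _≟ᶠ_)
open import Data.Vec.Base using (Vec; []; _∷_; lookup; tabulate)
import Data.List.Base as L
open import Data.List.Base using (List; length; filter; filterᵇ; upTo; allFin)
open import Data.Integer.Base using (+_)
open import Data.Rational.Base using (ℚ; _/_; _+_; 0ℚ)
open import Relation.Nullary.Decidable using (⌊_⌋)
open import Data.Bool.ListAction using (and)

-- A permutation of {0,…,n-1} in one-line notation: π i = lookup π i.
Arr : ℕ → Set
Arr n = Vec (Fin n) n

app : ∀ {n} → Arr n → Fin n → Fin n
app π i = lookup π i

allVecs : (n k : ℕ) → List (Vec (Fin n) k)
allVecs n zero    = [] L.∷ L.[]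
allVecs n (suc k) =
  L.concatMap (λ x → L.map (x ∷_) (allVecs n k)) (allFin n)

eqFinᵇ : ∀ {n} → Fin n → Fin n → Bool
eqFinᵇ i j = ⌊ i ≟ᶠ j ⌋

-- injectivity of i ↦ π i (on a finite set: equivalently bijectivity)
isInjectiveᵇ : ∀ {n} → Arr n → Bool
isInjectiveᵇ {n} π =
  and (L.map (λ i → and (L.map (λ j →
      if eqFinᵇ (app π i) (app π j) then eqFinᵇ i j else true)
    (allFin n))) (allFin n))

-- the symmetric group S_n, listed without repetition (n! elements)
Sym : (n : ℕ) → List (Arr n)
Sym n = filterᵇ isInjectiveᵇ (allVecs n n)

_∘π_ : ∀ {n} → Arr n → Arr n → Arr n
σ ∘π π = tabulate (λ i → app σ (app π i))

idπ : ∀ {n} → Arr n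
idπ = tabulate (λ i → i)

_^π_ : ∀ {n} → Arr n → ℕ → Arr n
π ^π zero  = idπ
π ^π suc k = π ∘π (π ^π k)

isIdᵇ : ∀ {n} → Arr n → Bool
isIdᵇ {n} π = and (L.map (λ i → eqFinᵇ (app π i) i) (allFin n))

-- least k ≥ start (searching `fuel` values) with π^k = id; 0 if none
firstId : ∀ {n} → Arr n → (fuel start : ℕ) → ℕ
firstId π zero       start = 0
firstId π (suc fuel) start =
  if isIdᵇ (π ^π start) then start else firstId π fuel (suc start)

-- order of π: least k ≥ 1 with π^k = id (it always exists with k ≤ n!,
-- so the search over 1 … n! never falls through).  ord of the empty
-- permutation of S_0 is 1.
ord : ∀ {n} → Arr n → ℕ
ord {n} π = firstId π (n !) 1

Prob : (n : ℕ) → (Arr n → Bool) → ℚ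
Prob n P = (+ length (filterᵇ P (Sym n))) / (n !)
  where instance _ = n !≢0

sumℚ : List ℚ → ℚ
sumℚ = L.foldr _+_ 0ℚ

τ : ℕ → ℕ
τ m = length (filter (λ d → d ∣? m) (L.map suc (upTo m)))

{-# OPTIONS --safe #-}
module Submission where

-- Write ℓ(x) for the length of the cycle of π through x, and call
-- lcm(ℓ(x) + j, lengths of the other cycles) the order of π stretched by j at x.
-- Every π ∈ S_{n+1} is (0 a) ∘ (0 ⊕ ρ) for exactly one a = π(0) and ρ ∈ S_n: 0 is a fixed
-- point if a = 0, and otherwise is inserted into the cycle of ρ through a - 1.  In the first
-- case the order of π stretched by j at 0 is lcm(ord ρ, j + 1); in the second it is the order
-- of ρ stretched by j + 1 at a - 1, which after conjugating ρ by (0 a-1) is the same as at 0.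
-- Counting, the number c(n, j) of π ∈ S_n with Q(stretched order at 0) satisfies
--   c(n + 1, j) = #{σ ∈ S_n | Q(lcm(ord σ, j + 1))} + n c(n, j + 1),
-- which unrolls to n c(n, 0) / n! = Σ_{n′ < n} P(Q(lcm(ord π_{n′}, n - n′))), i.e. the cycle
-- through 0 has uniformly distributed length.  For Q = (_≡ m) and Q = (_∣ m) the summands with
-- n - n′ ∤ m vanish; in the second case the others are at most 1, and there are at most τ(m).

open import Defs

module Combinatorics where

  open import Data.Bool.Base using (Bool; true; false; T; if_then_else_)
  open import Data.Empty using (⊥-elim)
  open import Data.Fin.Base as Fin using (Fin; zero; suc; toℕ; fromℕ<; punchOut)
  open import Data.Fin.Permutation.Components using (transpose)
  open import Data.Fin.Properties using (_≟_; any?; pigeonhole; toℕ<n; toℕ-fromℕ<; suc-injective; punchIn-punchOut)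
  open import Data.List.Base
    using ( List; []; _∷_; _++_; map; length; filter; filterᵇ; allFin; tabulate; cartesianProductWith; concatMap
          ; upTo; applyUpTo; applyDownFrom; reverse)
  open import Data.List.Properties
    using (length-++; length-filter; filter-all; filter-++; filter-none; length-tabulate; map-applyUpTo; reverse-applyUpTo)
  open import Data.List.Membership.Propositional using (_∈_)
  open import Data.List.Membership.Propositional.Properties
    using (∈-filter⁺; ∈-filter⁻; ∈-allFin; ∈-map⁺; ∈-map⁻; ∈-tabulate⁻)
  open import Data.List.Membership.Propositional.Properties.WithK using (unique∧set⇒bag)
  import Data.List.Membership.Setoid.Properties as SetoidMembership
  open import Data.List.Relation.Binary.BagAndSetEquality using (∼bag⇒↭)
  open import Data.List.Relation.Binary.Permutation.Propositional using (_↭_)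
  open import Data.List.Relation.Binary.Permutation.Propositional.Properties using (↭-length; filter-↭; ↭-reverse)
  import Data.List.Relation.Unary.All as All
  open import Data.List.Relation.Unary.All.Properties using (all⁺; all⁻; tabulate⁺; tabulate⁻; applyUpTo⁺₂)
  open import Data.List.Relation.Unary.Any using (here; there)
  open import Data.List.Relation.Unary.Unique.Propositional using (Unique; []; _∷_)
  import Data.List.Relation.Unary.Unique.Propositional.Properties as Unique
  open import Data.Nat.Base as ℕ
    using ( ℕ; zero; suc; pred; _+_; _*_; _∸_; _≤_; _<_; z≤n; s≤s; s≤s⁻¹; _!
          ; NonZero; ≢-nonZero; ≢-nonZero⁻¹; >-nonZero; >-nonZero⁻¹)
  open import Data.Nat.Properties
    using ( ≤-refl; ≤-trans; ≤-antisym; ≤-total; <-irrefl; <-trans; <-≤-trans; <⇒≤; ≮⇒≥; ≤⇒≯; <⇒≱; ≤∧≢⇒<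
          ; m≤n⇒m<n∨m≡n
          ; n<1+n; n≤1+n; m≤m+n; m≤m*n; m∸n≤m; m<n⇒0<n∸m; m+[n∸m]≡n; m∸n+n≡m; +-comm; +-suc; +-identityʳ; suc-pred; _!≢0
          ; module ≤-Reasoning)
  open import Data.Nat.DivMod using (_%_; _/_; m≡m%n+[m/n]*n; m%n<n)
  open import Data.Nat.Divisibility
    using ( _∣_; _∣?_; divides-refl; m%n≡0⇒n∣m; ∣⇒≤; ∣-antisym; ∣-refl; ∣-trans; 1∣_; 0∣⇒≡0
          ; m≤n⇒m!∣n!; m∣m*n)
  open import Data.Nat.LCM using (lcm; m∣lcm[m,n]; n∣lcm[m,n]; lcm-least)
  open import Data.Product.Base using (∃; _×_; _,_; proj₂)
  open import Data.Sum.Base using (inj₁; inj₂)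
  open import Data.Unit.Base using (tt)
  open import Data.Vec.Base as Vec using (Vec; []; _∷_; lookup)
  open import Data.Vec.Properties using (lookup∘tabulate; tabulate∘lookup; tabulate-cong; ∷-injective)
  open import Function.Base using (_∘_; const)
  open import Function.Bundles using (_⇔_; mk⇔; Equivalence)
  import Function.Properties.Equivalence as ⇔
  open import Function.Definitions using (Injective)
  open import Relation.Nullary using (¬_; Dec; yes; no; contradiction)
  open import Relation.Nullary.Decidable using (⌊_⌋; T?; toWitness; fromWitness; map′; dec-true; dec-false)
  open import Relation.Unary using (Decidable)
  open import Relation.Binary.PropositionalEquality

  private variable
    A B C : Set
    n : ℕ

  -- Counting in lists

  count : (A → Bool) → List A → ℕ
  count P xs = length (filterᵇ P xs)

  count-++ : (P : A → Bool) (xs ys : List A) → count P (xs ++ ys) ≡ count P xs + count P ys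
  count-++ P xs ys = trans (cong length (filter-++ (T? ∘ P) xs ys)) (length-++ (filterᵇ P xs))

  length-filter-map : ∀ {P : B → Set} (P? : Decidable P) (f : A → B) xs →
    length (filter P? (map f xs)) ≡ length (filter (P? ∘ f) xs)
  length-filter-map P? f []       = refl
  length-filter-map P? f (x ∷ xs) with P? (f x)
  ... | yes _ = cong suc (length-filter-map P? f xs)
  ... | no  _ = length-filter-map P? f xs

  count-map : (P : B → Bool) (f : A → B) (xs : List A) → count P (map f xs) ≡ count (P ∘ f) xs
  count-map P = length-filter-map (T? ∘ P)

  count-cong : {P Q : A → Bool} (xs : List A) → (∀ {x} → x ∈ xs → P x ≡ Q x) → count P xs ≡ count Q xs
  count-cong [] _ = refl
  count-cong {P = P} {Q} (x ∷ xs) P≡Q with P x | Q x | P≡Q (here refl)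
  ... | true  | true  | refl = cong suc (count-cong xs (P≡Q ∘ there))
  ... | false | false | refl = count-cong xs (P≡Q ∘ there)

  count-none : {P : A → Bool} (xs : List A) → (∀ {x} → x ∈ xs → P x ≡ false) → count P xs ≡ 0
  count-none [] _ = refl
  count-none {P = P} (x ∷ xs) P≡false with P x | P≡false (here refl)
  ... | false | refl = count-none xs (P≡false ∘ there)

  count-≤-length : (P : A → Bool) (xs : List A) → count P xs ≤ length xs
  count-≤-length P = length-filter (T? ∘ P)

  count-true : (xs : List A) → count (const true) xs ≡ length xs
  count-true xs = cong length (filter-all (T? ∘ const true) (All.universal _ xs))

  count-↭ : (P : A → Bool) {xs ys : List A} → xs ↭ ys → count P xs ≡ count P ys
  count-↭ P = ↭-length ∘ filter-↭ (T? ∘ P)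

  count-cartesianProductWith : (P : C → Bool) (f : A → B → C) (xs : List A) (ys : List B) {c : ℕ} →
    (∀ {x} → x ∈ xs → count (P ∘ f x) ys ≡ c) → count P (cartesianProductWith f xs ys) ≡ length xs * c
  count-cartesianProductWith P f [] ys _ = refl
  count-cartesianProductWith P f (x ∷ xs) ys {c} eq = begin
    count P (map (f x) ys ++ cartesianProductWith f xs ys)
      ≡⟨ count-++ P (map (f x) ys) _ ⟩
    count P (map (f x) ys) + count P (cartesianProductWith f xs ys)
      ≡⟨ cong₂ _+_ (trans (count-map P (f x) ys) (eq (here refl))) (count-cartesianProductWith P f xs ys (eq ∘ there)) ⟩
    c + length xs * c
      ∎
    where open ≡-Reasoning

  unique∧sameElements⇒↭ : {xs ys : List A} → Unique xs → Unique ys → (∀ {z} → z ∈ xs ⇔ z ∈ ys) → xs ↭ ys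
  unique∧sameElements⇒↭ xs! ys! xs≈ys = ∼bag⇒↭ (unique∧set⇒bag xs! ys! xs≈ys)

  ∈-cartesianProductWith⁺ : (f : A → B → C) {xs : List A} {ys : List B} {a : A} {b : B} →
    a ∈ xs → b ∈ ys → f a b ∈ cartesianProductWith f xs ys
  ∈-cartesianProductWith⁺ f = SetoidMembership.∈-cartesianProductWith⁺ (setoid _) (setoid _) (setoid _) (cong₂ f)

  concatMap-map≡cartesianProductWith : (f : A → B → C) (xs : List A) (ys : List B) →
    concatMap (λ x → map (f x) ys) xs ≡ cartesianProductWith f xs ys
  concatMap-map≡cartesianProductWith f []       ys = refl
  concatMap-map≡cartesianProductWith f (x ∷ xs) ys = cong (map (f x) ys ++_) (concatMap-map≡cartesianProductWith f xs ys)

  -- The enumeration Sym n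

  lookup-ext : {u v : Vec A n} → (∀ i → lookup u i ≡ lookup v i) → u ≡ v
  lookup-ext {u = u} {v} eq = trans (sym (tabulate∘lookup u)) (trans (tabulate-cong eq) (tabulate∘lookup v))

  allVecs-suc : ∀ n k → allVecs n (suc k) ≡ cartesianProductWith Vec._∷_ (allFin n) (allVecs n k)
  allVecs-suc n k = concatMap-map≡cartesianProductWith Vec._∷_ (allFin n) (allVecs n k)

  ∈-allVecs : ∀ {k} (v : Vec (Fin n) k) → v ∈ allVecs n k
  ∈-allVecs []      = here refl
  ∈-allVecs {n} {suc k} (x ∷ v) =
    subst ((x ∷ v) ∈_) (sym (allVecs-suc n k)) (∈-cartesianProductWith⁺ Vec._∷_ (∈-allFin x) (∈-allVecs v))

  allVecs-unique : ∀ n k → Unique (allVecs n k)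
  allVecs-unique n zero    = All.[] ∷ []
  allVecs-unique n (suc k) = subst Unique (sym (allVecs-suc n k))
    (Unique.cartesianProductWith⁺ Vec._∷_ ∷-injective (Unique.allFin⁺ n) (allVecs-unique n k))

  IsPermutation : Arr n → Set
  IsPermutation π = Injective _≡_ _≡_ (app π)

  T-isInjectiveᵇ : (π : Arr n) → T (isInjectiveᵇ π) ⇔ IsPermutation π
  T-isInjectiveᵇ {n} π = mk⇔
    (λ t {i} {j} → Equivalence.to (pair i j) (tabulate⁻ (all⁺ _ (allFin n) (tabulate⁻ (all⁺ _ (allFin n) t) i)) j))
    (λ inj → all⁻ _ (tabulate⁺ λ i → all⁻ _ (tabulate⁺ λ j → Equivalence.from (pair i j) (λ e → inj e))))
    where
    pair : ∀ i j → T (if eqFinᵇ (app π i) (app π j) then eqFinᵇ i j else true) ⇔ (app π i ≡ app π j → i ≡ j)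
    pair i j with app π i ≟ app π j
    ... | yes πi≡πj = mk⇔ (λ t _ → toWitness t) (λ h → fromWitness (h πi≡πj))
    ... | no  πi≢πj = mk⇔ (λ _ πi≡πj → ⊥-elim (πi≢πj πi≡πj)) (const tt)

  ∈-Sym⁻ : {π : Arr n} → π ∈ Sym n → IsPermutation π
  ∈-Sym⁻ {π = π} π∈ = Equivalence.to (T-isInjectiveᵇ π) (proj₂ (∈-filter⁻ (T? ∘ isInjectiveᵇ) {xs = allVecs _ _} π∈))

  ∈-Sym⁺ : {π : Arr n} → IsPermutation π → π ∈ Sym n
  ∈-Sym⁺ {π = π} inj = ∈-filter⁺ (T? ∘ isInjectiveᵇ) (∈-allVecs π) (Equivalence.from (T-isInjectiveᵇ π) inj)

  Sym-unique : ∀ n → Unique (Sym n)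
  Sym-unique n = Unique.filter⁺ (T? ∘ isInjectiveᵇ) (allVecs-unique n n)

  -- Cycles

  same-multiples⇒≡ : ∀ {a b} → (∀ t → a ∣ t ⇔ b ∣ t) → a ≡ b
  same-multiples⇒≡ {a} {b} a∣⇔b∣ = ∣-antisym (Equivalence.from (a∣⇔b∣ b) ∣-refl) (Equivalence.to (a∣⇔b∣ a) ∣-refl)

  lcm-∣⇔ : ∀ {a b t} → lcm a b ∣ t ⇔ (a ∣ t × b ∣ t)
  lcm-∣⇔ {a} {b} = mk⇔
    (λ lcm∣t → ∣-trans (m∣lcm[m,n] a b) lcm∣t , ∣-trans (n∣lcm[m,n] a b) lcm∣t)
    (λ (a∣t , b∣t) → lcm-least a∣t b∣t)

  lcmᶠ : (Fin n → ℕ) → ℕ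
  lcmᶠ {zero}  g = 1
  lcmᶠ {suc n} g = lcm (g zero) (lcmᶠ (g ∘ suc))

  lcmᶠ-∣⇔ : ∀ (g : Fin n → ℕ) {t} → lcmᶠ g ∣ t ⇔ (∀ i → g i ∣ t)
  lcmᶠ-∣⇔ {zero}  g {t} = mk⇔ (λ _ ()) (λ _ → 1∣ t)
  lcmᶠ-∣⇔ {suc n} g     = ⇔.trans lcm-∣⇔ (mk⇔
    (λ (g₀∣t , rest) → λ { zero → g₀∣t ; (suc i) → Equivalence.to (lcmᶠ-∣⇔ (g ∘ suc)) rest i })
    (λ all∣t → all∣t zero , Equivalence.from (lcmᶠ-∣⇔ (g ∘ suc)) (all∣t ∘ suc)))

  firstFrom : (ℕ → Bool) → (fuel start : ℕ) → ℕ
  firstFrom P zero       s = 0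
  firstFrom P (suc fuel) s = if P s then s else firstFrom P fuel (suc s)

  record IsFirstFrom (P : ℕ → Bool) (s r : ℕ) : Set where
    field
      start≤ : s ≤ r
      holds  : T (P r)
      first  : ∀ {t} → s ≤ t → t < r → ¬ T (P t)

  module _ {P : ℕ → Bool} {s r : ℕ} (isFirst : IsFirstFrom P s r) where
    open IsFirstFrom isFirst

    IsFirstFrom-≤ : ∀ {w} → s ≤ w → T (P w) → r ≤ w
    IsFirstFrom-≤ s≤w Pw = ≮⇒≥ λ w<r → first s≤w w<r Pw

  firstFrom-isFirst : ∀ P fuel s {w} → s ≤ w → w < s + fuel → T (P w) → IsFirstFrom P s (firstFrom P fuel s)
  firstFrom-isFirst P zero s s≤w w<s+0 _ = contradiction (subst (_ <_) (+-identityʳ s) w<s+0) (≤⇒≯ s≤w)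
  firstFrom-isFirst P (suc fuel) s {w} s≤w w<s+fuel Pw with P s in Ps
  ... | true  = record { start≤ = ≤-refl ; holds = subst T (sym Ps) _ ; first = λ s≤t t<s → contradiction t<s (≤⇒≯ s≤t) }
  ... | false = record { start≤ = ≤-trans (n≤1+n s) start≤ ; holds = holds ; first = first′ }
    where
    s≢w : s ≢ w
    s≢w refl = subst T Ps Pw
    open IsFirstFrom (firstFrom-isFirst P fuel (suc s) (≤∧≢⇒< s≤w s≢w) (subst (w <_) (+-suc s fuel) w<s+fuel) Pw)
    first′ : ∀ {t} → s ≤ t → t < firstFrom P fuel (suc s) → ¬ T (P t)
    first′ s≤t t<r with m≤n⇒m<n∨m≡n s≤t
    ... | inj₁ s<t  = first s<t t<r
    ... | inj₂ refl = subst T Ps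

  firstFrom-multiple : ∀ {P d} fuel .{{_ : NonZero d}} → (∀ k → T (P k) ⇔ d ∣ k) → d ≤ fuel → firstFrom P fuel 1 ≡ d
  firstFrom-multiple {P} {d} fuel P⇔d∣ d≤fuel = ≤-antisym
    (IsFirstFrom-≤ isFirst (>-nonZero⁻¹ d) (Equivalence.from (P⇔d∣ d) ∣-refl))
    (∣⇒≤ {{>-nonZero (IsFirstFrom.start≤ isFirst)}} (Equivalence.to (P⇔d∣ _) (IsFirstFrom.holds isFirst)))
    where
    isFirst = firstFrom-isFirst P fuel 1 (>-nonZero⁻¹ d) (s≤s d≤fuel) (Equivalence.from (P⇔d∣ d) ∣-refl)

  iter : (Fin n → Fin n) → ℕ → Fin n → Fin n
  iter f zero    x = x
  iter f (suc k) x = f (iter f k x)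

  module _ (f : Fin n → Fin n) where

    iter-+ : ∀ a b x → iter f (a + b) x ≡ iter f a (iter f b x)
    iter-+ zero    b x = refl
    iter-+ (suc a) b x = cong f (iter-+ a b x)

    iter-comm : ∀ a b x → iter f a (iter f b x) ≡ iter f b (iter f a x)
    iter-comm a b x = trans (sym (iter-+ a b x)) (trans (cong (λ k → iter f k x) (+-comm a b)) (iter-+ b a x))

    iter-* : ∀ {L x} q → iter f L x ≡ x → iter f (q * L) x ≡ x
    iter-* zero    _ = refl
    iter-* {L} {x} (suc q) fixed = trans (iter-+ L (q * L) x) (trans (cong (iter f L) (iter-* q fixed)) fixed)

  returnsAt : (Fin n → Fin n) → Fin n → ℕ → Bool
  returnsAt f x s = eqFinᵇ (iter f s x) x

  cycleLength : (Fin n → Fin n) → Fin n → ℕ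
  cycleLength {n} f x = firstFrom (returnsAt f x) n 1

  OnCycle : (Fin n → Fin n) → Fin n → Fin n → Set
  OnCycle f x y = ∃ λ s → iter f s x ≡ y

  module _ {f : Fin n → Fin n} (f-inj : Injective _≡_ _≡_ f) where

    iter-injective : ∀ k → Injective _≡_ _≡_ (iter f k)
    iter-injective zero    eq = eq
    iter-injective (suc k) eq = iter-injective k (f-inj eq)

    returns-within-n : ∀ x → ∃ λ d → 1 ≤ d × d ≤ n × iter f d x ≡ x
    returns-within-n x with pigeonhole (n<1+n n) (λ (i : Fin (suc n)) → iter f (toℕ i) x)
    ... | i , j , i<j , fⁱx≡fʲx =
      toℕ j ∸ toℕ i , m<n⇒0<n∸m i<j , ≤-trans (m∸n≤m (toℕ j) (toℕ i)) (s≤s⁻¹ (toℕ<n j)) ,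
      iter-injective (toℕ i) (begin
        iter f (toℕ i) (iter f (toℕ j ∸ toℕ i) x) ≡⟨ iter-+ f (toℕ i) _ x ⟨
        iter f (toℕ i + (toℕ j ∸ toℕ i)) x        ≡⟨ cong (λ k → iter f k x) (m+[n∸m]≡n (<⇒≤ i<j)) ⟩
        iter f (toℕ j) x                          ≡⟨ fⁱx≡fʲx ⟨
        iter f (toℕ i) x                          ∎)
      where open ≡-Reasoning

    cycleLength-isFirst : ∀ x → IsFirstFrom (returnsAt f x) 1 (cycleLength f x)
    cycleLength-isFirst x with returns-within-n x
    ... | d , 1≤d , d≤n , fᵈx≡x = firstFrom-isFirst (returnsAt f x) n 1 1≤d (s≤s d≤n) (fromWitness fᵈx≡x)

    cycleLength-nonZero : ∀ x → NonZero (cycleLength f x)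
    cycleLength-nonZero x = >-nonZero (IsFirstFrom.start≤ (cycleLength-isFirst x))

    cycleLength≤n : ∀ x → cycleLength f x ≤ n
    cycleLength≤n x with returns-within-n x
    ... | d , 1≤d , d≤n , fᵈx≡x = ≤-trans (IsFirstFrom-≤ (cycleLength-isFirst x) 1≤d (fromWitness fᵈx≡x)) d≤n

    iter-cycleLength : ∀ x → iter f (cycleLength f x) x ≡ x
    iter-cycleLength x = toWitness (IsFirstFrom.holds (cycleLength-isFirst x))

    iter<cycleLength : ∀ x {s} → 1 ≤ s → s < cycleLength f x → iter f s x ≢ x
    iter<cycleLength x 1≤s s<ℓ = IsFirstFrom.first (cycleLength-isFirst x) 1≤s s<ℓ ∘ fromWitness

    module _ (x : Fin n) where
      private
        L = cycleLength f x
        instance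
          L≢0 : NonZero L
          L≢0 = cycleLength-nonZero x

        iter-% : ∀ t → iter f (t % L) x ≡ iter f t x
        iter-% t = begin
          iter f (t % L) x                        ≡⟨ cong (iter f (t % L)) (iter-* f (t / L) (iter-cycleLength x)) ⟨
          iter f (t % L) (iter f ((t / L) * L) x) ≡⟨ iter-+ f (t % L) _ x ⟨
          iter f (t % L + (t / L) * L) x          ≡⟨ cong (λ k → iter f k x) (m≡m%n+[m/n]*n t L) ⟨
          iter f t x                              ∎
          where open ≡-Reasoning

      iter-reduce : ∀ t → ∃ λ r → r < cycleLength f x × iter f r x ≡ iter f t x
      iter-reduce t = t % L , m%n<n t L , iter-% t

      returns⇔cycleLength∣ : ∀ t → iter f t x ≡ x ⇔ cycleLength f x ∣ t
      returns⇔cycleLength∣ t = mk⇔ to from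
        where
        to : iter f t x ≡ x → L ∣ t
        to fᵗx≡x with t % L in t%L≡r
        ... | zero  = m%n≡0⇒n∣m t L t%L≡r
        ... | suc r = contradiction (trans (subst (λ k → iter f k x ≡ iter f t x) t%L≡r (iter-% t)) fᵗx≡x)
                        (iter<cycleLength x (s≤s z≤n) (subst (_< L) t%L≡r (m%n<n t L)))
        from : L ∣ t → iter f t x ≡ x
        from (divides-refl q) = iter-* f q (iter-cycleLength x)

  cycleLength-cong : ∀ {m} {f : Fin n → Fin n} {g : Fin m → Fin m} → Injective _≡_ _≡_ f → Injective _≡_ _≡_ g →
    ∀ {x y} → (∀ t → iter f t x ≡ x ⇔ iter g t y ≡ y) → cycleLength f x ≡ cycleLength g y
  cycleLength-cong f-inj g-inj {x} {y} same-returns = same-multiples⇒≡ λ t →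
    ⇔.trans (⇔.sym (returns⇔cycleLength∣ f-inj x t)) (⇔.trans (same-returns t) (returns⇔cycleLength∣ g-inj y t))

  module _ {f : Fin n → Fin n} (f-inj : Injective _≡_ _≡_ f) where

    onCycle-sym : ∀ {x y} → OnCycle f x y → OnCycle f y x
    onCycle-sym {x} (s , refl) = s * L ∸ s , (begin
      iter f (s * L ∸ s) (iter f s x) ≡⟨ iter-+ f (s * L ∸ s) s x ⟨
      iter f (s * L ∸ s + s) x        ≡⟨ cong (λ k → iter f k x) (m∸n+n≡m (m≤m*n s L)) ⟩
      iter f (s * L) x                ≡⟨ iter-* f s (iter-cycleLength f-inj x) ⟩
      x                               ∎)
      where
      open ≡-Reasoning
      L = cycleLength f x
      instance _ = cycleLength-nonZero f-inj x

    onCycle⇔bounded : ∀ {x y} → OnCycle f x y ⇔ ∃ λ (s : Fin n) → iter f (toℕ s) x ≡ y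
    onCycle⇔bounded {x} = mk⇔ bound (λ (s , fˢx≡y) → toℕ s , fˢx≡y)
      where
      bound : ∀ {y} → OnCycle f x y → ∃ λ (s : Fin n) → iter f (toℕ s) x ≡ y
      bound (t , refl) with iter-reduce f-inj x t
      ... | r , r<L , fʳx≡fᵗx = fromℕ< r<n , trans (cong (λ k → iter f k x) (toℕ-fromℕ< r<n)) fʳx≡fᵗx
        where r<n = <-≤-trans r<L (cycleLength≤n f-inj x)

    onCycle? : ∀ x y → Dec (OnCycle f x y)
    onCycle? x y = map′ (Equivalence.from onCycle⇔bounded) (Equivalence.to onCycle⇔bounded) (any? λ s → iter f (toℕ s) x ≟ y)

    cycleLength-onCycle : ∀ {x y} → OnCycle f x y → cycleLength f y ≡ cycleLength f x
    cycleLength-onCycle {x} (s , refl) = cycleLength-cong f-inj f-inj λ t → mk⇔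
      (λ fᵗfˢx≡fˢx → iter-injective f-inj s (trans (iter-comm f s t x) fᵗfˢx≡fˢx))
      (λ fᵗx≡x → trans (iter-comm f t s x) (cong (iter f s) fᵗx≡x))

    cycleLength-unique : ∀ {x u} → 1 ≤ u → iter f u x ≡ x → (∀ {s} → 1 ≤ s → s < u → iter f s x ≢ x) →
                         cycleLength f x ≡ u
    cycleLength-unique {x} {u} 1≤u fᵘx≡x no-earlier-return with m≤n⇒m<n∨m≡n (∣⇒≤ {{>-nonZero 1≤u}} ℓ∣u)
      where ℓ∣u = Equivalence.to (returns⇔cycleLength∣ f-inj x u) fᵘx≡x
    ... | inj₁ ℓ<u = contradiction (iter-cycleLength f-inj x) (no-earlier-return (>-nonZero⁻¹ _ {{cycleLength-nonZero f-inj x}}) ℓ<u)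
    ... | inj₂ ℓ≡u = ℓ≡u

  lengthOffCycle : (Fin n → Fin n) → Fin n → Fin n → ℕ
  lengthOffCycle {n} f x y = if ⌊ any? (λ (s : Fin n) → iter f (toℕ s) x ≟ y) ⌋ then 1 else cycleLength f y

  stretchedOrder : (Fin n → Fin n) → Fin n → ℕ → ℕ
  stretchedOrder f x j = lcm (cycleLength f x + j) (lcmᶠ (lengthOffCycle f x))

  OtherCyclesDivide : (Fin n → Fin n) → Fin n → ℕ → Set
  OtherCyclesDivide f x t = ∀ y → ¬ OnCycle f x y → cycleLength f y ∣ t

  module _ {f : Fin n → Fin n} (f-inj : Injective _≡_ _≡_ f) where

    lengthOffCycle-∣⇔ : ∀ {x y t} → lengthOffCycle f x y ∣ t ⇔ (¬ OnCycle f x y → cycleLength f y ∣ t)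
    lengthOffCycle-∣⇔ {x} {y} {t} with any? (λ (s : Fin n) → iter f (toℕ s) x ≟ y)
    ... | yes bounded = mk⇔ (λ _ off → contradiction (Equivalence.from (onCycle⇔bounded f-inj) bounded) off) (λ _ → 1∣ t)
    ... | no unbounded =
      mk⇔ (λ ℓ∣t _ → ℓ∣t) (λ off⇒ℓ∣t → off⇒ℓ∣t (unbounded ∘ Equivalence.to (onCycle⇔bounded f-inj)))

    stretchedOrder-∣⇔ : ∀ x j {t} → stretchedOrder f x j ∣ t ⇔ (cycleLength f x + j ∣ t × OtherCyclesDivide f x t)
    stretchedOrder-∣⇔ x j = ⇔.trans lcm-∣⇔ (mk⇔
      (λ (ℓ+j∣t , others) → ℓ+j∣t , λ y → Equivalence.to lengthOffCycle-∣⇔ (Equivalence.to (lcmᶠ-∣⇔ _) others y))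
      (λ (ℓ+j∣t , others) → ℓ+j∣t , Equivalence.from (lcmᶠ-∣⇔ _) λ y → Equivalence.from lengthOffCycle-∣⇔ (others y)))

  app-^π : (π : Arr n) (k : ℕ) (x : Fin n) → app (π ^π k) x ≡ iter (app π) k x
  app-^π π zero    x = lookup∘tabulate (λ i → i) x
  app-^π π (suc k) x = trans (lookup∘tabulate (λ i → app π (app (π ^π k) i)) x) (cong (app π) (app-^π π k x))

  T-isIdᵇ : (σ : Arr n) → T (isIdᵇ σ) ⇔ (∀ i → app σ i ≡ i)
  T-isIdᵇ {n} σ = mk⇔
    (λ t i → toWitness (tabulate⁻ (all⁺ _ (allFin n) t) i))
    (λ fixes → all⁻ _ (tabulate⁺ (fromWitness ∘ fixes)))

  firstId≡firstFrom : (π : Arr n) (fuel s : ℕ) → firstId π fuel s ≡ firstFrom (isIdᵇ ∘ (π ^π_)) fuel s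
  firstId≡firstFrom π zero       s = refl
  firstId≡firstFrom π (suc fuel) s = cong (if isIdᵇ (π ^π s) then s else_) (firstId≡firstFrom π fuel (suc s))

  module _ (π : Arr n) (π-perm : IsPermutation π) where

    private
      cycleLengths∣⇔ : ∀ t → T (isIdᵇ (π ^π t)) ⇔ (∀ y → cycleLength (app π) y ∣ t)
      cycleLengths∣⇔ t = ⇔.trans (T-isIdᵇ (π ^π t)) (mk⇔
        (λ fixes y → Equivalence.to (returns⇔cycleLength∣ π-perm y t) (trans (sym (app-^π π t y)) (fixes y)))
        (λ ℓ∣t y → trans (app-^π π t y) (Equivalence.from (returns⇔cycleLength∣ π-perm y t) (ℓ∣t y))))

    ord≡lcmᶠ-cycleLength : ord π ≡ lcmᶠ (cycleLength (app π))
    ord≡lcmᶠ-cycleLength = trans (firstId≡firstFrom π (n !) 1)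
      (firstFrom-multiple (n !) {{G≢0}} (λ k → ⇔.trans (cycleLengths∣⇔ k) (⇔.sym (lcmᶠ-∣⇔ _))) (∣⇒≤ {{n !≢0}} G∣n!))
      where
      G = lcmᶠ (cycleLength (app π))
      ℓ∣n! : ∀ y → cycleLength (app π) y ∣ n !
      ℓ∣n! y with cycleLength (app π) y | cycleLength-nonZero π-perm y | cycleLength≤n π-perm y
      ... | suc ℓ | _ | ℓ<n = ∣-trans (m∣m*n (ℓ !)) (m≤n⇒m!∣n! ℓ<n)
      G∣n! : G ∣ n !
      G∣n! = Equivalence.from (lcmᶠ-∣⇔ _) ℓ∣n!
      G≢0 : NonZero G
      G≢0 = ≢-nonZero λ G≡0 → ≢-nonZero⁻¹ (n !) {{n !≢0}} (0∣⇒≡0 (subst (_∣ n !) G≡0 G∣n!))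

    ord-∣⇔ : ∀ {t} → ord π ∣ t ⇔ (∀ y → cycleLength (app π) y ∣ t)
    ord-∣⇔ {t} = subst (λ d → d ∣ t ⇔ (∀ y → cycleLength (app π) y ∣ t))
      (sym ord≡lcmᶠ-cycleLength) (lcmᶠ-∣⇔ (cycleLength (app π)))

    stretchedOrder-zero : ∀ x → stretchedOrder (app π) x 0 ≡ ord π
    stretchedOrder-zero x = same-multiples⇒≡ λ t → ⇔.trans (stretchedOrder-∣⇔ π-perm x 0) (mk⇔
      (λ (ℓ∣t , others) → Equivalence.from ord-∣⇔ λ y → on-or-off y (subst (_∣ t) (+-identityʳ _) ℓ∣t) (others y))
      (λ ord∣t → let ℓ∣t = Equivalence.to ord-∣⇔ ord∣t in
        subst (_∣ t) (sym (+-identityʳ _)) (ℓ∣t x) , λ y _ → ℓ∣t y))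
      where
      on-or-off : ∀ {t} y → cycleLength (app π) x ∣ t → (¬ OnCycle (app π) x y → cycleLength (app π) y ∣ t) →
                  cycleLength (app π) y ∣ t
      on-or-off y ℓₓ∣t off with onCycle? π-perm x y
      ... | yes on = subst (_∣ _) (sym (cycleLength-onCycle π-perm on)) ℓₓ∣t
      ... | no ¬on = off ¬on

  -- Inserting 0 into a permutation

  module _ (i j : Fin n) where

    transpose-matchˡ : transpose i j i ≡ j
    transpose-matchˡ rewrite dec-true (i ≟ i) refl = refl

    transpose-matchʳ : transpose i j j ≡ i
    transpose-matchʳ with j ≟ i
    ... | yes j≡i = j≡i
    ... | no  j≢i rewrite dec-true (j ≟ j) refl = refl

    transpose-other : ∀ {k} → k ≢ i → k ≢ j → transpose i j k ≡ k
    transpose-other {k} k≢i k≢j rewrite dec-false (k ≟ i) k≢i | dec-false (k ≟ j) k≢j = refl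

    transpose-involutive : ∀ k → transpose i j (transpose i j k) ≡ k
    transpose-involutive k = by-cases (k ≟ i) (k ≟ j)
      where
      by-cases : Dec (k ≡ i) → Dec (k ≡ j) → transpose i j (transpose i j k) ≡ k
      by-cases (yes refl) _          = trans (cong (transpose i j) transpose-matchˡ) transpose-matchʳ
      by-cases (no _)     (yes refl) = trans (cong (transpose i j) transpose-matchʳ) transpose-matchˡ
      by-cases (no k≢i)   (no k≢j)   = trans (cong (transpose i j) (transpose-other k≢i k≢j)) (transpose-other k≢i k≢j)

    transpose-injective : Injective _≡_ _≡_ (transpose i j)
    transpose-injective {k} {l} eq = trans (sym (transpose-involutive k)) (trans (cong (transpose i j) eq) (transpose-involutive l))

  extendZero : Arr n → Fin (suc n) → Fin (suc n)
  extendZero ρ zero    = zero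
  extendZero ρ (suc y) = suc (app ρ y)

  insertZero : Fin (suc n) → Arr n → Arr (suc n)
  insertZero a ρ = Vec.tabulate (transpose zero a ∘ extendZero ρ)

  module _ (a : Fin (suc n)) (ρ : Arr n) where

    app-insertZero : ∀ z → app (insertZero a ρ) z ≡ transpose zero a (extendZero ρ z)
    app-insertZero = lookup∘tabulate (transpose zero a ∘ extendZero ρ)

    insertZero-zero : app (insertZero a ρ) zero ≡ a
    insertZero-zero = trans (app-insertZero zero) (transpose-matchˡ zero a)

    insertZero-isPermutation : IsPermutation ρ → IsPermutation (insertZero a ρ)
    insertZero-isPermutation ρ-perm {z} {w} eq =
      extendZero-injective z w (transpose-injective zero a (trans (sym (app-insertZero z)) (trans eq (app-insertZero w))))
      where
      extendZero-injective : ∀ z w → extendZero ρ z ≡ extendZero ρ w → z ≡ w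
      extendZero-injective zero    zero    _  = refl
      extendZero-injective (suc y) (suc v) eq = cong suc (ρ-perm (suc-injective eq))

  insertZero-injective : ∀ {a b : Fin (suc n)} {ρ σ} → insertZero a ρ ≡ insertZero b σ → a ≡ b × ρ ≡ σ
  insertZero-injective {a = a} {b} {ρ} {σ} eq = a≡b , lookup-ext λ y →
    suc-injective (transpose-injective zero a (begin
      transpose zero a (suc (app ρ y))  ≡⟨ app-insertZero a ρ (suc y) ⟨
      app (insertZero a ρ) (suc y)      ≡⟨ cong (λ π → app π (suc y)) eq ⟩
      app (insertZero b σ) (suc y)      ≡⟨ app-insertZero b σ (suc y) ⟩
      transpose zero b (suc (app σ y))  ≡⟨ cong (λ c → transpose zero c (suc (app σ y))) a≡b ⟨
      transpose zero a (suc (app σ y))  ∎))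
    where
    open ≡-Reasoning
    a≡b : a ≡ b
    a≡b = trans (sym (insertZero-zero a ρ)) (trans (cong (λ π → app π zero) eq) (insertZero-zero b σ))

  module _ (π : Arr (suc n)) (π-perm : IsPermutation π) where

    private
      swap₀ = transpose zero (app π zero)

      zero≢image : ∀ y → zero ≢ swap₀ (app π (suc y))
      zero≢image y 0≡image = contradiction (π-perm π[suc-y]≡π[0]) λ ()
        where
        π[suc-y]≡π[0] : app π (suc y) ≡ app π zero
        π[suc-y]≡π[0] = begin
          app π (suc y)                  ≡⟨ transpose-involutive zero (app π zero) (app π (suc y)) ⟨
          swap₀ (swap₀ (app π (suc y)))  ≡⟨ cong swap₀ 0≡image ⟨
          swap₀ zero                     ≡⟨ transpose-matchˡ zero (app π zero) ⟩
          app π zero                     ∎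
          where open ≡-Reasoning

    deleteZero : Arr n
    deleteZero = Vec.tabulate λ y → punchOut (zero≢image y)

    private
      suc-deleteZero : ∀ y → suc (app deleteZero y) ≡ swap₀ (app π (suc y))
      suc-deleteZero y = trans (cong suc (lookup∘tabulate _ y)) (punchIn-punchOut (zero≢image y))

    deleteZero-isPermutation : IsPermutation deleteZero
    deleteZero-isPermutation eq =
      suc-injective (π-perm (transpose-injective zero (app π zero) (trans (sym (suc-deleteZero _)) (trans (cong suc eq) (suc-deleteZero _)))))

    insertZero-deleteZero : insertZero (app π zero) deleteZero ≡ π
    insertZero-deleteZero = lookup-ext λ where
      zero    → insertZero-zero _ deleteZero
      (suc y) → trans (app-insertZero (app π zero) deleteZero (suc y))
                  (trans (cong swap₀ (suc-deleteZero y)) (transpose-involutive zero _ _))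

  Sym-suc-↭ : ∀ n → Sym (suc n) ↭ cartesianProductWith insertZero (allFin (suc n)) (Sym n)
  Sym-suc-↭ n = unique∧sameElements⇒↭ (Sym-unique (suc n))
    (Unique.cartesianProductWith⁺ insertZero insertZero-injective (Unique.allFin⁺ (suc n)) (Sym-unique n))
    (mk⇔ decompose compose)
    where
    decompose : ∀ {π} → π ∈ Sym (suc n) → π ∈ cartesianProductWith insertZero (allFin (suc n)) (Sym n)
    decompose {π} π∈ = let π-perm = ∈-Sym⁻ π∈ in
      subst (_∈ _) (insertZero-deleteZero π π-perm)
        (∈-cartesianProductWith⁺ insertZero (∈-allFin (app π zero))
          (∈-Sym⁺ {π = deleteZero π π-perm} (deleteZero-isPermutation π π-perm)))
    compose : ∀ {π} → π ∈ cartesianProductWith insertZero (allFin (suc n)) (Sym n) → π ∈ Sym (suc n)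
    compose π∈ with SetoidMembership.∈-cartesianProductWith⁻ (setoid _) (setoid _) (setoid _) insertZero (allFin (suc n)) (Sym n) π∈
    ... | a , ρ , _ , ρ∈ , refl = ∈-Sym⁺ (insertZero-isPermutation a ρ (∈-Sym⁻ ρ∈))

  Sym-size : ∀ n → length (Sym n) ≡ n !
  Sym-size zero    = refl
  Sym-size (suc n) = begin
    length (Sym (suc n))                                                   ≡⟨ count-true (Sym (suc n)) ⟨
    count (const true) (Sym (suc n))                                       ≡⟨ count-↭ _ (Sym-suc-↭ n) ⟩
    count (const true) (cartesianProductWith insertZero (allFin (suc n)) (Sym n))
      ≡⟨ count-cartesianProductWith _ insertZero (allFin (suc n)) (Sym n) (λ _ → trans (count-true (Sym n)) (Sym-size n)) ⟩
    length (allFin (suc n)) * n !                                          ≡⟨ cong (_* n !) (length-tabulate {n = suc n} (λ i → i)) ⟩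
    suc n * n !                                                            ∎
    where open ≡-Reasoning

  conjugate : Fin n → Fin n → Arr n → Arr n
  conjugate i j ρ = Vec.tabulate (transpose i j ∘ app ρ ∘ transpose i j)

  module _ (i j : Fin n) where

    private
      swap = transpose i j
      swap-involutive = transpose-involutive i j

    app-conjugate : ∀ ρ k → app (conjugate i j ρ) k ≡ swap (app ρ (swap k))
    app-conjugate ρ = lookup∘tabulate (swap ∘ app ρ ∘ swap)

    iter-conjugate : ∀ ρ s x → iter (app (conjugate i j ρ)) s (swap x) ≡ swap (iter (app ρ) s x)
    iter-conjugate ρ zero    x = refl
    iter-conjugate ρ (suc s) x = begin
      app (conjugate i j ρ) (iter (app (conjugate i j ρ)) s (swap x)) ≡⟨ cong (app (conjugate i j ρ)) (iter-conjugate ρ s x) ⟩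
      app (conjugate i j ρ) (swap (iter (app ρ) s x))                 ≡⟨ app-conjugate ρ _ ⟩
      swap (app ρ (swap (swap (iter (app ρ) s x))))                          ≡⟨ cong (swap ∘ app ρ) (swap-involutive _) ⟩
      swap (app ρ (iter (app ρ) s x))                                  ∎
      where open ≡-Reasoning

    conjugate-involutive : ∀ ρ → conjugate i j (conjugate i j ρ) ≡ ρ
    conjugate-involutive ρ = lookup-ext λ k → begin
      app (conjugate i j (conjugate i j ρ)) k ≡⟨ app-conjugate (conjugate i j ρ) k ⟩
      swap (app (conjugate i j ρ) (swap k))         ≡⟨ cong swap (app-conjugate ρ (swap k)) ⟩
      swap (swap (app ρ (swap (swap k))))                 ≡⟨ swap-involutive _ ⟩
      app ρ (swap (swap k))                         ≡⟨ cong (app ρ) (swap-involutive k) ⟩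
      app ρ k                                 ∎
      where open ≡-Reasoning

    conjugate-isPermutation : ∀ ρ → IsPermutation ρ → IsPermutation (conjugate i j ρ)
    conjugate-isPermutation ρ ρ-perm {k} {l} eq = transpose-injective i j (ρ-perm (transpose-injective i j
      (trans (sym (app-conjugate ρ k)) (trans eq (app-conjugate ρ l)))))

    map-conjugate-↭ : map (conjugate i j) (Sym n) ↭ Sym n
    map-conjugate-↭ = unique∧sameElements⇒↭
      (Unique.map⁺ conjugate-injective (Sym-unique n)) (Sym-unique n) (mk⇔ from-image into-image)
      where
      conjugate-injective : ∀ {ρ σ} → conjugate i j ρ ≡ conjugate i j σ → ρ ≡ σ
      conjugate-injective {ρ} {σ} eq = trans (sym (conjugate-involutive ρ)) (trans (cong (conjugate i j) eq) (conjugate-involutive σ))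
      from-image : ∀ {π} → π ∈ map (conjugate i j) (Sym n) → π ∈ Sym n
      from-image π∈ with ∈-map⁻ (conjugate i j) π∈
      ... | ρ , ρ∈ , refl = ∈-Sym⁺ (conjugate-isPermutation ρ (∈-Sym⁻ ρ∈))
      into-image : ∀ {π} → π ∈ Sym n → π ∈ map (conjugate i j) (Sym n)
      into-image {π} π∈ = subst (_∈ _) (conjugate-involutive π)
        (∈-map⁺ (conjugate i j) (∈-Sym⁺ {π = conjugate i j π} (conjugate-isPermutation π (∈-Sym⁻ π∈))))

    module _ (ρ : Arr n) (ρ-perm : IsPermutation ρ) where

      private
        ρ′ = conjugate i j ρ
        ρ′-perm = conjugate-isPermutation ρ ρ-perm

      cycleLength-conjugate : ∀ x → cycleLength (app ρ′) (swap x) ≡ cycleLength (app ρ) x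
      cycleLength-conjugate x = cycleLength-cong ρ′-perm ρ-perm λ t → mk⇔
        (λ eq → transpose-injective i j (trans (sym (iter-conjugate ρ t x)) eq))
        (λ eq → trans (iter-conjugate ρ t x) (cong swap eq))

      onCycle-conjugate : ∀ {x y} → OnCycle (app ρ′) (swap x) (swap y) ⇔ OnCycle (app ρ) x y
      onCycle-conjugate {x} = mk⇔
        (λ (s , eq) → s , transpose-injective i j (trans (sym (iter-conjugate ρ s x)) eq))
        (λ (s , eq) → s , trans (iter-conjugate ρ s x) (cong swap eq))

      stretchedOrder-conjugate : ∀ x k → stretchedOrder (app ρ′) (swap x) k ≡ stretchedOrder (app ρ) x k
      stretchedOrder-conjugate x k = same-multiples⇒≡ λ t →
        ⇔.trans (stretchedOrder-∣⇔ ρ′-perm (swap x) k) (⇔.trans (mk⇔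
          (λ (ℓ+k∣t , others) → subst (λ ℓ → ℓ + k ∣ t) (cycleLength-conjugate x) ℓ+k∣t , λ y off →
            subst (_∣ t) (cycleLength-conjugate y) (others (swap y) (off ∘ Equivalence.to onCycle-conjugate)))
          (λ (ℓ+k∣t , others) → subst (λ ℓ → ℓ + k ∣ t) (sym (cycleLength-conjugate x)) ℓ+k∣t , λ z off →
            subst (λ w → cycleLength (app ρ′) w ∣ t) (swap-involutive z)
              (subst (_∣ t) (sym (cycleLength-conjugate (swap z)))
                (others (swap z) (off ∘ subst (OnCycle (app ρ′) (swap x)) (swap-involutive z) ∘ Equivalence.from onCycle-conjugate)))))
          (⇔.sym (stretchedOrder-∣⇔ ρ-perm x k)))

  module _ (ρ : Arr n) (ρ-perm : IsPermutation ρ) where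

    module _ (a : Fin (suc n)) where

      private
        π = insertZero a ρ

      iter-insertZero-suc : ∀ {y} → (∀ s → suc (iter (app ρ) s y) ≢ a) →
                            ∀ s → iter (app π) s (suc y) ≡ suc (iter (app ρ) s y)
      iter-insertZero-suc avoids zero    = refl
      iter-insertZero-suc {y} avoids (suc s) = begin
        app π (iter (app π) s (suc y))                  ≡⟨ cong (app π) (iter-insertZero-suc avoids s) ⟩
        app π (suc (iter (app ρ) s y))                  ≡⟨ app-insertZero a ρ (suc (iter (app ρ) s y)) ⟩
        transpose zero a (suc (iter (app ρ) (suc s) y)) ≡⟨ transpose-other zero a (λ ()) (avoids (suc s)) ⟩
        suc (iter (app ρ) (suc s) y)                    ∎
        where open ≡-Reasoning

      cycleLength-insertZero-suc : ∀ {y} → (∀ s → suc (iter (app ρ) s y) ≢ a) →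
                                   cycleLength (app π) (suc y) ≡ cycleLength (app ρ) y
      cycleLength-insertZero-suc avoids = cycleLength-cong (insertZero-isPermutation a ρ ρ-perm) ρ-perm λ t → mk⇔
        (λ eq → suc-injective (trans (sym (iter-insertZero-suc avoids t)) eq))
        (λ eq → trans (iter-insertZero-suc avoids t) (cong suc eq))

    module _ where

      private
        π = insertZero zero ρ
        π-perm = insertZero-isPermutation zero ρ ρ-perm
        avoids : ∀ {y} (s : ℕ) → _≢_ {A = Fin (suc n)} (suc (iter (app ρ) s y)) zero
        avoids _ ()

      iter-insertZero₀-zero : ∀ s → iter (app π) s zero ≡ zero
      iter-insertZero₀-zero zero    = refl
      iter-insertZero₀-zero (suc s) = trans (cong (app π) (iter-insertZero₀-zero s)) (insertZero-zero zero ρ)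

      stretchedOrder-insertZero₀ : ∀ j → stretchedOrder (app π) zero j ≡ lcm (ord ρ) (suc j)
      stretchedOrder-insertZero₀ j = same-multiples⇒≡ λ t →
        ⇔.trans (stretchedOrder-∣⇔ π-perm zero j) (⇔.trans (mk⇔
          (λ (ℓ+j∣t , others) → subst (λ ℓ → ℓ + j ∣ t) cycleLength₀ ℓ+j∣t ,
            Equivalence.from (ord-∣⇔ ρ ρ-perm) λ y →
            subst (_∣ t) (cycleLength-insertZero-suc zero avoids) (others (suc y) λ (s , eq) →
              contradiction (trans (sym (iter-insertZero₀-zero s)) eq) λ ()))
          (λ (1+j∣t , ord∣t) → subst (λ ℓ → ℓ + j ∣ t) (sym cycleLength₀) 1+j∣t , λ where
            zero    off → contradiction (0 , refl) off
            (suc y) _   → subst (_∣ t) (sym (cycleLength-insertZero-suc zero avoids)) (Equivalence.to (ord-∣⇔ ρ ρ-perm) ord∣t y)))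
          (⇔.trans (mk⇔ (λ (a , b) → b , a) (λ (a , b) → b , a)) (⇔.sym lcm-∣⇔)))
        where
        cycleLength₀ : cycleLength (app π) zero ≡ 1
        cycleLength₀ = cycleLength-unique π-perm ≤-refl (iter-insertZero₀-zero 1)
          λ 1≤s s<1 → contradiction (<-≤-trans s<1 1≤s) (<-irrefl refl)

    module _ (a : Fin n) where

      private
        π = insertZero (suc a) ρ
        π-perm = insertZero-isPermutation (suc a) ρ ρ-perm
        L = cycleLength (app ρ) a
        instance
          L≢0 : NonZero L
          L≢0 = cycleLength-nonZero ρ-perm a

      iter-insertZero-zero : ∀ {s} → s < L → iter (app π) (suc s) zero ≡ suc (iter (app ρ) s a)
      iter-insertZero-zero {zero}  _     = insertZero-zero (suc a) ρ
      iter-insertZero-zero {suc s} 1+s<L = begin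
        app π (iter (app π) (suc s) zero)
          ≡⟨ cong (app π) (iter-insertZero-zero (<-trans (n<1+n s) 1+s<L)) ⟩
        app π (suc (iter (app ρ) s a))
          ≡⟨ app-insertZero (suc a) ρ (suc (iter (app ρ) s a)) ⟩
        transpose zero (suc a) (suc (iter (app ρ) (suc s) a))
          ≡⟨ transpose-other zero (suc a) (λ ()) (not-back-yet ∘ suc-injective) ⟩
        suc (iter (app ρ) (suc s) a)
          ∎
        where
        open ≡-Reasoning
        not-back-yet = iter<cycleLength ρ-perm a (s≤s z≤n) 1+s<L

      cycleLength-insertZero-zero : cycleLength (app π) zero ≡ suc L
      cycleLength-insertZero-zero = cycleLength-unique π-perm (s≤s z≤n) returns no-earlier-return
        where
        no-earlier-return : ∀ {s} → 1 ≤ s → s < suc L → iter (app π) s zero ≢ zero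
        no-earlier-return {suc s} _ 1+s<1+L eq =
          contradiction (trans (sym (iter-insertZero-zero (s≤s⁻¹ 1+s<1+L))) eq) λ ()
        returns : iter (app π) (suc L) zero ≡ zero
        returns = begin
          app π (iter (app π) L zero)
            ≡⟨ cong (λ k → app π (iter (app π) k zero)) (suc-pred L) ⟨
          app π (iter (app π) (suc (pred L)) zero)
            ≡⟨ cong (app π) (iter-insertZero-zero (subst (pred L <_) (suc-pred L) ≤-refl)) ⟩
          app π (suc (iter (app ρ) (pred L) a))
            ≡⟨ app-insertZero (suc a) ρ (suc (iter (app ρ) (pred L) a)) ⟩
          transpose zero (suc a) (suc (iter (app ρ) (suc (pred L)) a))
            ≡⟨ cong (λ k → transpose zero (suc a) (suc (iter (app ρ) k a))) (suc-pred L) ⟩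
          transpose zero (suc a) (suc (iter (app ρ) L a))
            ≡⟨ cong (transpose zero (suc a) ∘ suc) (iter-cycleLength ρ-perm a) ⟩
          transpose zero (suc a) (suc a)
            ≡⟨ transpose-matchʳ zero (suc a) ⟩
          zero
            ∎
          where open ≡-Reasoning

      onCycle-insertZero : ∀ {y} → OnCycle (app π) zero (suc y) ⇔ OnCycle (app ρ) a y
      onCycle-insertZero {y} = mk⇔
        (λ (s , eq) → to {s} eq (iter-reduce π-perm zero s))
        (λ (s , eq) → from {s} eq (iter-reduce ρ-perm a s))
        where
        to : ∀ {s} → iter (app π) s zero ≡ suc y →
             ∃ (λ r → r < cycleLength (app π) zero × iter (app π) r zero ≡ iter (app π) s zero) → OnCycle (app ρ) a y
        to eq (zero  , _   , eq′) = contradiction (trans eq′ eq) λ ()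
        to eq (suc r , r<ℓ , eq′) = r , suc-injective (begin
          suc (iter (app ρ) r a)     ≡⟨ iter-insertZero-zero (s≤s⁻¹ (subst (suc r <_) cycleLength-insertZero-zero r<ℓ)) ⟨
          iter (app π) (suc r) zero  ≡⟨ trans eq′ eq ⟩
          suc y                      ∎)
          where open ≡-Reasoning
        from : ∀ {s} → iter (app ρ) s a ≡ y →
               ∃ (λ r → r < L × iter (app ρ) r a ≡ iter (app ρ) s a) → OnCycle (app π) zero (suc y)
        from eq (r , r<L , eq′) = suc r , trans (iter-insertZero-zero r<L) (cong suc (trans eq′ eq))

      stretchedOrder-insertZero : ∀ j → stretchedOrder (app π) zero j ≡ stretchedOrder (app ρ) a (suc j)
      stretchedOrder-insertZero j = same-multiples⇒≡ λ t →
        ⇔.trans (stretchedOrder-∣⇔ π-perm zero j) (⇔.trans (mk⇔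
          (λ (ℓ+j∣t , others) → subst (_∣ t) ℓ-shift ℓ+j∣t , λ y off →
            subst (_∣ t) (cycleLength-off off) (others (suc y) (off ∘ Equivalence.to onCycle-insertZero)))
          (λ (ℓ+j∣t , others) → subst (_∣ t) (sym ℓ-shift) ℓ+j∣t , λ where
            zero    off → contradiction (0 , refl) off
            (suc y) off → let off′ = off ∘ Equivalence.from onCycle-insertZero in
                          subst (_∣ t) (sym (cycleLength-off off′)) (others y off′)))
          (⇔.sym (stretchedOrder-∣⇔ ρ-perm a (suc j))))
        where
        ℓ-shift : cycleLength (app π) zero + j ≡ L + suc j
        ℓ-shift = trans (cong (_+ j) cycleLength-insertZero-zero) (sym (+-suc L j))
        cycleLength-off : ∀ {y} → ¬ OnCycle (app ρ) a y → cycleLength (app π) (suc y) ≡ cycleLength (app ρ) y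
        cycleLength-off off = cycleLength-insertZero-suc (suc a) λ s eq → off (onCycle-sym ρ-perm (s , suc-injective eq))

  -- The recurrence

  stretchedCount : (ℕ → Bool) → ℕ → ℕ → ℕ
  stretchedCount Q zero    j = 0
  stretchedCount Q (suc n) j = count (λ π → Q (stretchedOrder (app π) zero j)) (Sym (suc n))

  stretchedCount-basepoint : ∀ Q (x : Fin (suc n)) j →
    count (λ ρ → Q (stretchedOrder (app ρ) x j)) (Sym (suc n)) ≡ stretchedCount Q (suc n) j
  stretchedCount-basepoint {n} Q x j = begin
    count (λ ρ → Q (stretchedOrder (app ρ) x j)) (Sym (suc n))
      ≡⟨ count-cong (Sym (suc n)) (λ {ρ} ρ∈ → cong Q (moveToZero ρ (∈-Sym⁻ ρ∈))) ⟩
    count (P ∘ conjugate zero x) (Sym (suc n))  ≡⟨ count-map P (conjugate zero x) (Sym (suc n)) ⟨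
    count P (map (conjugate zero x) (Sym (suc n))) ≡⟨ count-↭ P (map-conjugate-↭ zero x) ⟩
    count P (Sym (suc n))                       ∎
    where
    open ≡-Reasoning
    P = λ π → Q (stretchedOrder (app π) zero j)
    moveToZero : ∀ ρ → IsPermutation ρ → stretchedOrder (app ρ) x j ≡ stretchedOrder (app (conjugate zero x ρ)) zero j
    moveToZero ρ ρ-perm = trans (sym (stretchedOrder-conjugate zero x ρ ρ-perm x j))
      (cong (λ z → stretchedOrder (app (conjugate zero x ρ)) z j) (transpose-matchʳ zero x))

  count-insertZero₀ : ∀ Q n j → count (λ ρ → Q (stretchedOrder (app (insertZero zero ρ)) zero j)) (Sym n)
                                ≡ count (λ σ → Q (lcm (ord σ) (suc j))) (Sym n)
  count-insertZero₀ Q n j = count-cong (Sym n) λ {ρ} ρ∈ → cong Q (stretchedOrder-insertZero₀ ρ (∈-Sym⁻ ρ∈) j)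

  count-insertZero-suc : ∀ Q {n} (a : Fin n) j → count (λ ρ → Q (stretchedOrder (app (insertZero (suc a) ρ)) zero j)) (Sym n)
                                               ≡ stretchedCount Q n (suc j)
  count-insertZero-suc Q {suc n} a j = trans
    (count-cong (Sym (suc n)) λ {ρ} ρ∈ → cong Q (stretchedOrder-insertZero ρ (∈-Sym⁻ ρ∈) a j))
    (stretchedCount-basepoint Q a (suc j))

  stretchedCount-suc : ∀ Q n j →
    stretchedCount Q (suc n) j ≡ count (λ σ → Q (lcm (ord σ) (suc j))) (Sym n) + n * stretchedCount Q n (suc j)
  stretchedCount-suc Q n j = begin
    count P (Sym (suc n))
      ≡⟨ count-↭ P (Sym-suc-↭ n) ⟩
    count P (cartesianProductWith insertZero (allFin (suc n)) (Sym n))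
      ≡⟨ count-++ P (map (insertZero zero) (Sym n)) _ ⟩
    count P (map (insertZero zero) (Sym n)) + count P (cartesianProductWith insertZero (tabulate suc) (Sym n))
      ≡⟨ cong₂ _+_ (trans (count-map P (insertZero zero) (Sym n)) (count-insertZero₀ Q n j))
                   (count-cartesianProductWith P insertZero (tabulate suc) (Sym n) insertAtSuc) ⟩
    D + length (tabulate {n = n} Fin.suc) * stretchedCount Q n (suc j)
      ≡⟨ cong (λ k → D + k * stretchedCount Q n (suc j)) (length-tabulate {n = n} Fin.suc) ⟩
    D + n * stretchedCount Q n (suc j)
      ∎
    where
    open ≡-Reasoning
    D = count (λ σ → Q (lcm (ord σ) (suc j))) (Sym n)
    P : Arr (suc n) → Bool
    P π = Q (stretchedOrder (app π) zero j)
    insertAtSuc : ∀ {x} → x ∈ tabulate suc → count (P ∘ insertZero x) (Sym n) ≡ stretchedCount Q n (suc j)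
    insertAtSuc x∈ with ∈-tabulate⁻ x∈
    ... | a , refl = count-insertZero-suc Q a j

  applyUpTo-+ : ∀ (f : ℕ → A) a b → applyUpTo f (a + b) ≡ applyUpTo f a ++ applyUpTo (f ∘ (a +_)) b
  applyUpTo-+ f zero    b = refl
  applyUpTo-+ f (suc a) b = cong (f 0 ∷_) (applyUpTo-+ (f ∘ suc) a b)

  applyUpTo-∸ : ∀ n → applyUpTo (n ∸_) n ≡ applyDownFrom suc n
  applyUpTo-∸ zero    = refl
  applyUpTo-∸ (suc n) = cong (suc n ∷_) (applyUpTo-∸ n)

  divisorsUpTo : ℕ → ℕ → ℕ
  divisorsUpTo m n = length (filter (_∣? m) (applyUpTo suc n))

  divisorsUpTo-+ : ∀ m a b → divisorsUpTo m (a + b) ≡ divisorsUpTo m a + length (filter (_∣? m) (applyUpTo (ℕ.suc ∘ (a +_)) b))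
  divisorsUpTo-+ m a b = trans (cong (length ∘ filter (_∣? m)) (applyUpTo-+ suc a b))
    (trans (cong length (filter-++ (_∣? m) (applyUpTo suc a) _)) (length-++ (filter (_∣? m) (applyUpTo suc a))))

  τ≡divisorsUpTo : ∀ m → τ m ≡ divisorsUpTo m m
  τ≡divisorsUpTo m = cong (length ∘ filter (_∣? m)) (map-applyUpTo (λ i → i) suc m)

  divisorsUpTo-≤-τ : ∀ m .{{_ : NonZero m}} n → divisorsUpTo m n ≤ τ m
  divisorsUpTo-≤-τ m n with ≤-total n m
  ... | inj₁ n≤m = begin
    divisorsUpTo m n                 ≤⟨ m≤m+n _ _ ⟩
    divisorsUpTo m n + _             ≡⟨ divisorsUpTo-+ m n (m ∸ n) ⟨
    divisorsUpTo m (n + (m ∸ n))     ≡⟨ cong (divisorsUpTo m) (m+[n∸m]≡n n≤m) ⟩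
    divisorsUpTo m m                 ≡⟨ τ≡divisorsUpTo m ⟨
    τ m                              ∎
    where open ≤-Reasoning
  ... | inj₂ m≤n = begin
    divisorsUpTo m n                 ≡⟨ cong (divisorsUpTo m) (m+[n∸m]≡n m≤n) ⟨
    divisorsUpTo m (m + (n ∸ m))     ≡⟨ divisorsUpTo-+ m m (n ∸ m) ⟩
    divisorsUpTo m m + length (filter (_∣? m) (applyUpTo (ℕ.suc ∘ (m +_)) (n ∸ m)))
      ≡⟨ cong (λ xs → divisorsUpTo m m + length xs) (filter-none (_∣? m) (applyUpTo⁺₂ _ (n ∸ m) too-large)) ⟩
    divisorsUpTo m m + 0             ≡⟨ +-identityʳ _ ⟩
    divisorsUpTo m m                 ≡⟨ τ≡divisorsUpTo m ⟨
    τ m                              ∎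
    where
    open ≤-Reasoning
    too-large : ∀ i → ¬ suc (m + i) ∣ m
    too-large i d = <⇒≱ (s≤s (m≤m+n m i)) (∣⇒≤ d)

  filter-upTo-∸ : ∀ (m n : ℕ) → length (filter (λ n′ → (n ∸ n′) ∣? m) (upTo n)) ≡ divisorsUpTo m n
  filter-upTo-∸ m n = begin
    length (filter (λ n′ → (n ∸ n′) ∣? m) (upTo n))
      ≡⟨ length-filter-map (_∣? m) (n ∸_) (upTo n) ⟨
    length (filter (_∣? m) (map (n ∸_) (upTo n)))
      ≡⟨ cong (length ∘ filter (_∣? m)) (trans (map-applyUpTo (λ i → i) (n ∸_) n) (applyUpTo-∸ n)) ⟩
    length (filter (_∣? m) (applyDownFrom suc n))
      ≡⟨ cong (length ∘ filter (_∣? m)) (reverse-applyUpTo suc n) ⟨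
    length (filter (_∣? m) (reverse (applyUpTo suc n)))
      ≡⟨ ↭-length (filter-↭ (_∣? m) (↭-reverse (applyUpTo suc n))) ⟩
    divisorsUpTo m n
      ∎
    where open ≡-Reasoning

open Combinatorics

open import Data.Bool.Base using (Bool; false)
open import Data.Fin.Base using (zero)
open import Data.Integer.Base as ℤ using (+_; +≤+)
import Data.Integer.Properties as ℤ
open import Data.List.Base using (List; []; _∷_; _∷ʳ_; map; filter; length; upTo)
open import Data.List.Properties using (upTo-∷ʳ; map-++; map-cong)
open import Data.List.Membership.Propositional using (_∈_)
open import Data.Nat.Base as ℕ using (ℕ; zero; suc; _∸_; _≡ᵇ_; _!; NonZero; z≤n)
open import Data.Nat.Properties using (_!≢0; m*n≢0; +-suc; m+n∸n≡m; *-identityˡ; *-identityʳ; *-monoˡ-≤; ≤-trans; ≤-reflexive)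
  renaming (_≟_ to _≟ℕ_)
open import Data.Nat.Divisibility using (_∣_; _∣?_; ∣-trans)
open import Data.Nat.LCM using (lcm; n∣lcm[m,n])
open import Data.Nat.Tactic.RingSolver using (solve-∀)
open import Data.Product.Base using (_×_; _,_)
open import Data.Rational.Base using (ℚ; _/_; _+_; _*_; _≤_; 0ℚ; 1ℚ; NonNegative; nonNegative; fromℚᵘ)
import Data.Rational.Properties as ℚ
open import Data.Rational.Properties
  using (fromℚᵘ-cong; fromℚᵘ-toℚᵘ; toℚᵘ-fromℚᵘ; toℚᵘ-homo-+; toℚᵘ-homo-*; toℚᵘ-cancel-≤)
import Data.Rational.Unnormalised.Base as ℚᵘ
import Data.Rational.Unnormalised.Properties as ℚᵘ
open import Function.Base using (_∘_)
open import Relation.Nullary using (¬_; yes; no)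
open import Relation.Nullary.Decidable using (⌊_⌋; dec-false; isYes≗does)
open import Relation.Unary using (Decidable)
open import Relation.Binary.PropositionalEquality

private variable
  A : Set

-- Probabilities

fromℚᵘ-homo-+ : ∀ p q → fromℚᵘ p + fromℚᵘ q ≡ fromℚᵘ (p ℚᵘ.+ q)
fromℚᵘ-homo-+ p q = trans (sym (fromℚᵘ-toℚᵘ _))
  (fromℚᵘ-cong (ℚᵘ.≃-trans (toℚᵘ-homo-+ (fromℚᵘ p) (fromℚᵘ q))
                           (ℚᵘ.+-cong (toℚᵘ-fromℚᵘ p) (toℚᵘ-fromℚᵘ q))))

fromℚᵘ-homo-* : ∀ p q → fromℚᵘ p * fromℚᵘ q ≡ fromℚᵘ (p ℚᵘ.* q)
fromℚᵘ-homo-* p q = trans (sym (fromℚᵘ-toℚᵘ _))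
  (fromℚᵘ-cong (ℚᵘ.≃-trans (toℚᵘ-homo-* (fromℚᵘ p) (fromℚᵘ q))
                           (ℚᵘ.*-cong (toℚᵘ-fromℚᵘ p) (toℚᵘ-fromℚᵘ q))))

/-cross-≡ : ∀ a b c d .{{_ : NonZero b}} .{{_ : NonZero d}} → a ℕ.* d ≡ c ℕ.* b → (+ a) / b ≡ (+ c) / d
/-cross-≡ a (suc b-1) c (suc d-1) ad≡cb = fromℚᵘ-cong {ℚᵘ.mkℚᵘ (+ a) b-1} {ℚᵘ.mkℚᵘ (+ c) d-1}
  (ℚᵘ.*≡* (trans (sym (ℤ.pos-* a (suc d-1))) (trans (cong +_ ad≡cb) (ℤ.pos-* c (suc b-1)))))

/-cross-≤ : ∀ a b c d .{{_ : NonZero b}} .{{_ : NonZero d}} → a ℕ.* d ℕ.≤ c ℕ.* b → (+ a) / b ≤ (+ c) / d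
/-cross-≤ a (suc b-1) c (suc d-1) ad≤cb = toℚᵘ-cancel-≤
  (ℚᵘ.≤-respʳ-≃ (ℚᵘ.≃-sym (toℚᵘ-fromℚᵘ (ℚᵘ.mkℚᵘ (+ c) d-1)))
    (ℚᵘ.≤-respˡ-≃ (ℚᵘ.≃-sym (toℚᵘ-fromℚᵘ (ℚᵘ.mkℚᵘ (+ a) b-1)))
      (ℚᵘ.*≤* (subst₂ ℤ._≤_ (ℤ.pos-* a (suc d-1)) (ℤ.pos-* c (suc b-1)) (+≤+ ad≤cb)))))

/-+-/ : ∀ a b c d .{{_ : NonZero b}} .{{_ : NonZero d}} →
  (+ a) / b + (+ c) / d ≡ _/_ (+ (a ℕ.* d ℕ.+ c ℕ.* b)) (b ℕ.* d) {{m*n≢0 b d}}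
/-+-/ a (suc b-1) c (suc d-1) = trans (fromℚᵘ-homo-+ (ℚᵘ.mkℚᵘ (+ a) b-1) (ℚᵘ.mkℚᵘ (+ c) d-1))
  (cong (λ N → fromℚᵘ (ℚᵘ.mkℚᵘ N (d-1 ℕ.+ b-1 ℕ.* suc d-1)))
    (trans (cong₂ ℤ._+_ (sym (ℤ.pos-* a (suc d-1))) (sym (ℤ.pos-* c (suc b-1)))) (sym (ℤ.pos-+ (a ℕ.* suc d-1) (c ℕ.* suc b-1)))))

/-*-/ : ∀ a b c d .{{_ : NonZero b}} .{{_ : NonZero d}} →
  ((+ a) / b) * ((+ c) / d) ≡ _/_ (+ (a ℕ.* c)) (b ℕ.* d) {{m*n≢0 b d}}
/-*-/ a (suc b-1) c (suc d-1) = trans (fromℚᵘ-homo-* (ℚᵘ.mkℚᵘ (+ a) b-1) (ℚᵘ.mkℚᵘ (+ c) d-1))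
  (cong (λ N → fromℚᵘ (ℚᵘ.mkℚᵘ N (d-1 ℕ.+ b-1 ℕ.* suc d-1))) (sym (ℤ.pos-* a c)))

/-+-distrib : ∀ m .{{_ : NonZero m}} a b → (+ (a ℕ.+ b)) / m ≡ (+ a) / m + (+ b) / m
/-+-distrib m a b = sym (trans (/-+-/ a m b m) (/-cross-≡ (a ℕ.* m ℕ.+ b ℕ.* m) (m ℕ.* m) (a ℕ.+ b) m {{m*n≢0 m m}} (lemma a b m)))
  where
  lemma : ∀ a b m → (a ℕ.* m ℕ.+ b ℕ.* m) ℕ.* m ≡ (a ℕ.+ b) ℕ.* (m ℕ.* m)
  lemma = solve-∀

1/-*-/ : ∀ b c d .{{_ : NonZero b}} .{{_ : NonZero d}} → ((+ 1) / b) * ((+ c) / d) ≡ _/_ (+ c) (b ℕ.* d) {{m*n≢0 b d}}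
1/-*-/ b c d = trans (/-*-/ 1 b c d) (cong (λ k → _/_ (+ k) (b ℕ.* d) {{m*n≢0 b d}}) (*-identityˡ c))

infix 7 _/!_
_/!_ : ℕ → ℕ → ℚ
c /! n = (+ c) / n !
  where instance _ = n !≢0

/!-+ : ∀ a b n → (a ℕ.+ b) /! n ≡ a /! n + b /! n
/!-+ a b n = /-+-distrib (n !) {{n !≢0}} a b

/!-suc : ∀ c n → c /! suc n ≡ ((+ 1) / suc n) * (c /! n)
/!-suc c n = sym (1/-*-/ (suc n) c (n !) {{_}} {{n !≢0}})

*-/!-suc : ∀ c n → (suc n ℕ.* c) /! suc n ≡ c /! n
*-/!-suc c n = /-cross-≡ (suc n ℕ.* c) (suc n !) c (n !) {{suc n !≢0}} {{n !≢0}} (lemma (suc n) c (n !))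
  where
  lemma : ∀ k c f → k ℕ.* c ℕ.* f ≡ c ℕ.* (k ℕ.* f)
  lemma = solve-∀

sumℚ-∷ʳ : ∀ (xs : List ℚ) x → sumℚ (xs ∷ʳ x) ≡ sumℚ xs + x
sumℚ-∷ʳ []       x = trans (ℚ.+-identityʳ x) (sym (ℚ.+-identityˡ x))
sumℚ-∷ʳ (y ∷ xs) x = trans (cong (_+_ y) (sumℚ-∷ʳ xs x)) (sym (ℚ.+-assoc y (sumℚ xs) x))

sumℚ-filter : {P : A → Set} (P? : Decidable P) (f : A → ℚ) (xs : List A) →
  (∀ x → ¬ P x → f x ≡ 0ℚ) → sumℚ (map f (filter P? xs)) ≡ sumℚ (map f xs)
sumℚ-filter P? f []       _ = refl
sumℚ-filter P? f (x ∷ xs) vanishes with P? x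
... | yes _  = cong (_+_ (f x)) (sumℚ-filter P? f xs vanishes)
... | no ¬Px = trans (sumℚ-filter P? f xs vanishes)
                 (trans (sym (ℚ.+-identityˡ _)) (cong (_+ sumℚ (map f xs)) (sym (vanishes x ¬Px))))

sumℚ-≤-length : (f : A → ℚ) (xs : List A) → (∀ x → f x ≤ 1ℚ) → sumℚ (map f xs) ≤ (+ length xs) / 1
sumℚ-≤-length f []       _  = ℚ.≤-refl
sumℚ-≤-length f (x ∷ xs) ≤1 =
  ℚ.≤-trans (ℚ.+-mono-≤ (≤1 x) (sumℚ-≤-length f xs ≤1)) (ℚ.≤-reflexive (sym (/-+-distrib 1 1 (length xs))))

Prob-≤-1 : ∀ n (P : Arr n → Bool) → Prob n P ≤ 1ℚ
Prob-≤-1 n P = /-cross-≤ (count P (Sym n)) (n !) 1 1 {{n !≢0}} (begin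
  count P (Sym n) ℕ.* 1 ≡⟨ *-identityʳ _ ⟩
  count P (Sym n)       ≤⟨ count-≤-length P (Sym n) ⟩
  length (Sym n)        ≡⟨ Sym-size n ⟩
  n !                   ≡⟨ *-identityˡ (n !) ⟨
  1 ℕ.* n !             ∎)
  where open Data.Nat.Properties.≤-Reasoning

Prob-none : ∀ n (P : Arr n → Bool) → (∀ π → P π ≡ false) → Prob n P ≡ 0ℚ
Prob-none n P never = trans (cong (_/! n) (count-none (Sym n) λ {π} _ → never π)) (ℚ.0/n≡0 (n !) {{n !≢0}})

stretchedCount-sum : ∀ Q n j → (n ℕ.* stretchedCount Q n j) /! n ≡
  sumℚ (map (λ n′ → Prob n′ (λ σ → Q (lcm (ord σ) (j ℕ.+ n ∸ n′)))) (upTo n))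
stretchedCount-sum Q zero    j = refl
stretchedCount-sum Q (suc n) j = begin
  (suc n ℕ.* C) /! suc n                            ≡⟨ *-/!-suc C n ⟩
  C /! n                                            ≡⟨ cong (_/! n) (stretchedCount-suc Q n j) ⟩
  (D ℕ.+ n ℕ.* stretchedCount Q n (suc j)) /! n     ≡⟨ /!-+ D _ n ⟩
  D /! n + (n ℕ.* stretchedCount Q n (suc j)) /! n  ≡⟨ cong (_+_ (D /! n)) (stretchedCount-sum Q n (suc j)) ⟩
  D /! n + sumℚ (map term′ (upTo n))                ≡⟨ ℚ.+-comm (D /! n) _ ⟩
  sumℚ (map term′ (upTo n)) + D /! n
    ≡⟨ cong₂ _+_ (cong sumℚ (map-cong term′≗term (upTo n))) (cong (term₀ n) (sym last)) ⟩
  sumℚ (map term (upTo n)) + term n                 ≡⟨ sumℚ-∷ʳ (map term (upTo n)) (term n) ⟨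
  sumℚ (map term (upTo n) ∷ʳ term n)                ≡⟨ cong sumℚ (map-++ term (upTo n) (n ∷ [])) ⟨
  sumℚ (map term (upTo n ∷ʳ n))                     ≡⟨ cong (sumℚ ∘ map term) (upTo-∷ʳ n) ⟩
  sumℚ (map term (upTo (suc n)))                    ∎
  where
  open ≡-Reasoning
  C = stretchedCount Q (suc n) j
  D = count (λ σ → Q (lcm (ord σ) (suc j))) (Sym n)
  term₀ : ℕ → ℕ → ℚ
  term₀ n′ k = Prob n′ (λ σ → Q (lcm (ord σ) k))
  term term′ : ℕ → ℚ
  term  n′ = term₀ n′ (j ℕ.+ suc n ∸ n′)
  term′ n′ = term₀ n′ (suc j ℕ.+ n ∸ n′)
  term′≗term : ∀ n′ → term′ n′ ≡ term n′
  term′≗term n′ = cong (λ k → term₀ n′ (k ∸ n′)) (sym (+-suc j n))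
  last : j ℕ.+ suc n ∸ n ≡ suc j
  last = trans (cong (_∸ n) (+-suc j n)) (m+n∸n≡m (suc j) n)

prob-ord : ∀ Q n .{{_ : NonZero n}} →
  Prob n (Q ∘ ord) ≡ ((+ 1) / n) * sumℚ (map (λ n′ → Prob n′ (λ σ → Q (lcm (ord σ) (n ∸ n′)))) (upTo n))
prob-ord Q (suc n) = begin
  Prob (suc n) (Q ∘ ord)                      ≡⟨ cong (_/! suc n) (count-cong (Sym (suc n)) via-stretchedOrder) ⟩
  C /! suc n                                  ≡⟨ /!-suc C n ⟩
  ((+ 1) / suc n) * (C /! n)                  ≡⟨ cong (((+ 1) / suc n) *_) (*-/!-suc C n) ⟨
  ((+ 1) / suc n) * ((suc n ℕ.* C) /! suc n)  ≡⟨ cong (((+ 1) / suc n) *_) (stretchedCount-sum Q (suc n) 0) ⟩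
  ((+ 1) / suc n) * sumℚ (map (λ n′ → Prob n′ (λ σ → Q (lcm (ord σ) (suc n ∸ n′)))) (upTo (suc n))) ∎
  where
  open ≡-Reasoning
  C = stretchedCount Q (suc n) 0
  via-stretchedOrder : ∀ {π} → π ∈ Sym (suc n) → Q (ord π) ≡ Q (stretchedOrder (app π) zero 0)
  via-stretchedOrder {π} π∈ = cong Q (sym (stretchedOrder-zero π (∈-Sym⁻ π∈) zero))

prob-ord-divisors : ∀ Q m n .{{_ : NonZero n}} → (∀ a k → ¬ k ∣ m → Q (lcm a k) ≡ false) →
  Prob n (Q ∘ ord) ≡
  ((+ 1) / n) * sumℚ (map (λ n′ → Prob n′ (λ σ → Q (lcm (ord σ) (n ∸ n′)))) (filter (λ n′ → (n ∸ n′) ∣? m) (upTo n)))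
prob-ord-divisors Q m n vanishes = trans (prob-ord Q n) (cong (((+ 1) / n) *_) (sym
  (sumℚ-filter (λ n′ → (n ∸ n′) ∣? m) _ (upTo n) λ n′ ∤m → Prob-none n′ _ λ σ → vanishes (ord σ) (n ∸ n′) ∤m)))

lcm≡ᵇ-false : ∀ m a k → ¬ k ∣ m → (lcm a k ≡ᵇ m) ≡ false
lcm≡ᵇ-false m a k k∤m = dec-false (lcm a k ≟ℕ m) λ lcm≡m → k∤m (subst (k ∣_) lcm≡m (n∣lcm[m,n] a k))

lcm∣?-false : ∀ m a k → ¬ k ∣ m → ⌊ lcm a k ∣? m ⌋ ≡ false
lcm∣?-false m a k k∤m = trans (isYes≗does (lcm a k ∣? m)) (dec-false (lcm a k ∣? m) (k∤m ∘ ∣-trans (n∣lcm[m,n] a k)))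

prob-ord∣-≤ : ∀ n .{{_ : NonZero n}} m .{{_ : NonZero m}} → Prob n (λ π → ⌊ ord π ∣? m ⌋) ≤ (+ τ m) / n
prob-ord∣-≤ n m = begin
  Prob n (λ π → ⌊ ord π ∣? m ⌋)           ≡⟨ prob-ord-divisors (λ k → ⌊ k ∣? m ⌋) m n (lcm∣?-false m) ⟩
  ((+ 1) / n) * sumℚ (map term divisors)  ≤⟨ ℚ.*-monoˡ-≤-nonNeg ((+ 1) / n) {{1/n-nonNeg}} sum≤τ ⟩
  ((+ 1) / n) * ((+ τ m) / 1)             ≡⟨ trans (1/-*-/ n (τ m) 1) (/-cross-≡ (τ m) (n ℕ.* 1) (τ m) n {{m*n≢0 n 1}} (lemma n (τ m))) ⟩
  (+ τ m) / n                             ∎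
  where
  open ℚ.≤-Reasoning
  divisors = filter (λ n′ → (n ∸ n′) ∣? m) (upTo n)
  term = λ n′ → Prob n′ (λ σ → ⌊ lcm (ord σ) (n ∸ n′) ∣? m ⌋)
  sum≤τ : sumℚ (map term divisors) ≤ (+ τ m) / 1
  sum≤τ = ℚ.≤-trans (sumℚ-≤-length term divisors (λ n′ → Prob-≤-1 n′ _))
    (/-cross-≤ (length divisors) 1 (τ m) 1 (*-monoˡ-≤ 1 (≤-trans (≤-reflexive (filter-upTo-∸ m n)) (divisorsUpTo-≤-τ m n))))
  1/n-nonNeg : NonNegative ((+ 1) / n)
  1/n-nonNeg = nonNegative (/-cross-≤ 0 1 1 n z≤n)
  lemma : ∀ n t → t ℕ.* n ≡ t ℕ.* (n ℕ.* 1)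
  lemma = solve-∀

corollary2p2 : ((n : ℕ) → .{{_ : NonZero n}} → (m : ℕ) →
      Prob n (λ π → ord π ≡ᵇ m)
        ≡ ((+ 1) / n) * sumℚ (map (λ n′ → Prob n′ (λ π → lcm (ord π) (n ∸ n′) ≡ᵇ m))
                                  (filter (λ n′ → (n ∸ n′) ∣? m) (upTo n))))
    ×
    ((n : ℕ) → .{{_ : NonZero n}} → (m : ℕ) → .{{_ : NonZero m}} →
      Prob n (λ π → ⌊ ord π ∣? m ⌋) ≤ (+ τ m) / n)
corollary2p2 = (λ n m → prob-ord-divisors (_≡ᵇ m) m n (lcm≡ᵇ-false m)) , prob-ord∣-≤
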